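{- Let $n\ge 1$ and $\operatorname{Ł}_{n+1}=\{0,\tfrac1n,\dots,\tfrac{n-1}{n},1\}$ with $x\oplus y=\min\{1,x+y\}$, $x^*=1-x$. Then the CMV-subalgebra of $\operatorname{Ł}_{n+1}^{\operatorname{Ł}_{n+1}}$ generated by the constant functions equals the whole CMV-algebra $\operatorname{Ł}_{n+1}^{\operatorname{Ł}_{n+1}}$.
   Context: A CMV-algebra is a structure $\langle A,\oplus,{}^*,0,\diamond,i\rangle$ such that $\langle A,\oplus,{}^*,0\rangle$ is an MV-algebra, $\langle A,\diamond,i\rangle$ is a monoid, and for all $x,y,z$: $(y\oplus z)\diamond x=(y\diamond x)\oplus(z\diamond x)$, $x^*\diamond y=(x\diamond y)^*$, $0\diamond x=0$. For an MV-algebra $M$, $M^M$ denotes the set of all functions $M\to M$ with pointwise MV-operations, function composition as $\diamond$ and the identity map as $i$; it is a CMV-algebra. A CMV-subalgebra is a subset closed under $\oplus,{}^*,0,\circ$ and containing the identity map. For $c\in M$, the constant function $c_c$ is $x\mapsto c$. -}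

module Defs where

open import Data.Nat using (ℕ; suc; _+_; _⊓_; _≤_; s≤s)
open import Data.Nat.Properties using (m⊓n≤n)
open import Data.Fin using (Fin; toℕ; fromℕ<; opposite)
open import Function using (_∘_; id)

-- The Łukasiewicz chain Ł_{n+1} = {0, 1/n, ..., 1}: the element k/n is
-- represented by k : Fin (suc n).
Ł : ℕ → Set
Ł n = Fin (suc n)

-- x ⊕ y = min{1, x + y}, i.e. on numerators min{n, i + j}
_⊕_ : {n : ℕ} → Ł n → Ł n → Ł n
_⊕_ {n} i j = fromℕ< {(toℕ i + toℕ j) ⊓ n} (s≤s (m⊓n≤n (toℕ i + toℕ j) n))

-- x* = 1 - x, i.e. on numerators n - i
_* : {n : ℕ} → Ł n → Ł n
_* = opposite

𝟘 : {n : ℕ} → Ł n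
𝟘 = Fin.zero

_⊕ᶠ_ : {n : ℕ} → (Ł n → Ł n) → (Ł n → Ł n) → (Ł n → Ł n)
(f ⊕ᶠ g) x = f x ⊕ g x

_*ᶠ : {n : ℕ} → (Ł n → Ł n) → (Ł n → Ł n)
(f *ᶠ) x = (f x) *

0ᶠ : {n : ℕ} → Ł n → Ł n
0ᶠ x = 𝟘

const : {n : ℕ} → Ł n → (Ł n → Ł n)
const c x = c

data Generated {n : ℕ} : (Ł n → Ł n) → Set where
  gen-const : (c : Ł n) → Generated (const c)
  gen-zero  : Generated 0ᶠ
  gen-id    : Generated id
  gen-⊕     : {f g : Ł n → Ł n} → Generated f → Generated g → Generated (f ⊕ᶠ g)
  gen-*     : {f : Ł n → Ł n} → Generated f → Generated (f *ᶠ)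
  gen-∘     : {f g : Ł n → Ł n} → Generated f → Generated g → Generated (f ∘ g)

-- Elements of Ł n are numerators k of k/n, so every MV-identity we need is
-- an identity about natural numbers.  From ⊕ and * we derive truncated
-- subtraction x ⊖ y = (x* ⊕ y)*, whose numerator is x ∸ y.  Three
-- derived term operations then do all the work:
--   * sign x = x ⊕ ... ⊕ x (n summands) is 0 at 0 and 1 elsewhere;
--   * dist x a = (x ⊖ a) ⊕ (a ⊖ x) vanishes exactly at x = a;
--   * ite e u v = (u ⊖ e*) ⊕ (v ⊖ e) is "if e then u else v" for e ∈ {0,1}.
-- Hence x ↦ ite (sign (dist x a)) (g x) (f a) agrees with f at a and with g
-- elsewhere.  Folding this over a list of points interpolates f on that
-- list; every step is built from id, constants, ⊕, * and composition, so
-- the interpolant is in the generated subalgebra.  Interpolating on the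
-- list of all elements of Ł n yields f itself.
module Submission where

open import Defs
open import Data.Nat using (ℕ; zero; suc; _+_; _*_; _∸_; _⊓_; _⊔_; _≤_)
open import Data.Nat.Properties hiding (_≟_)
open import Data.Fin using (toℕ; _≟_)
open import Data.Fin.Properties using (toℕ-injective; toℕ≤pred[n]; toℕ-fromℕ<; opposite-prop; opposite-involutive)
open import Data.List using (List; []; _∷_; allFin)
open import Data.List.Relation.Unary.Any using (here; there)
open import Data.List.Membership.Propositional using (_∈_)
open import Data.List.Membership.Propositional.Properties using (∈-allFin)
open import Data.Product using (Σ; _×_; _,_)
open import Data.Empty using (⊥-elim)
open import Relation.Nullary using (¬_; yes; no)
open import Relation.Binary.PropositionalEquality
open ≡-Reasoning

module _ {n : ℕ} where

  ⊤ : Ł n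
  ⊤ = 𝟘 *

  toℕ-⊤ : toℕ ⊤ ≡ n
  toℕ-⊤ = opposite-prop {suc n} 𝟘

  toℕ≤n : (x : Ł n) → toℕ x ≤ n
  toℕ≤n = toℕ≤pred[n]

  toℕ-⊕ : (x y : Ł n) → toℕ (x ⊕ y) ≡ (toℕ x + toℕ y) ⊓ n
  toℕ-⊕ x y = toℕ-fromℕ< _

  ⊕-identityˡ : (x : Ł n) → 𝟘 ⊕ x ≡ x
  ⊕-identityˡ x = toℕ-injective (trans (toℕ-⊕ 𝟘 x) (m≤n⇒m⊓n≡m (toℕ≤n x)))

  ⊕-identityʳ : (x : Ł n) → x ⊕ 𝟘 ≡ x
  ⊕-identityʳ x = toℕ-injective (begin
    toℕ (x ⊕ 𝟘)       ≡⟨ toℕ-⊕ x 𝟘 ⟩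
    (toℕ x + 0) ⊓ n   ≡⟨ cong (_⊓ n) (+-identityʳ (toℕ x)) ⟩
    toℕ x ⊓ n         ≡⟨ m≤n⇒m⊓n≡m (toℕ≤n x) ⟩
    toℕ x             ∎)

  ⊕-inflationaryˡ : (x y : Ł n) → toℕ x ≤ toℕ (x ⊕ y)
  ⊕-inflationaryˡ x y = subst₂ _≤_ (m≤n⇒m⊓n≡m (toℕ≤n x)) (sym (toℕ-⊕ x y))
    (⊓-monoˡ-≤ n (m≤m+n (toℕ x) (toℕ y)))

  ⊕-inflationaryʳ : (x y : Ł n) → toℕ y ≤ toℕ (x ⊕ y)
  ⊕-inflationaryʳ x y = subst₂ _≤_ (m≤n⇒m⊓n≡m (toℕ≤n y)) (sym (toℕ-⊕ x y))
    (⊓-monoˡ-≤ n (m≤n+m (toℕ y) (toℕ x)))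

  _⊖_ : Ł n → Ł n → Ł n
  x ⊖ y = ((x *) ⊕ y) *

  toℕ-⊖ : (x y : Ł n) → toℕ (x ⊖ y) ≡ toℕ x ∸ toℕ y
  toℕ-⊖ x y = begin
    toℕ (((x *) ⊕ y) *)                       ≡⟨ opposite-prop ((x *) ⊕ y) ⟩
    n ∸ toℕ ((x *) ⊕ y)                       ≡⟨ cong (n ∸_) (toℕ-⊕ (x *) y) ⟩
    n ∸ ((toℕ (x *) + toℕ y) ⊓ n)             ≡⟨ ∸-distribˡ-⊓-⊔ n (toℕ (x *) + toℕ y) n ⟩
    (n ∸ (toℕ (x *) + toℕ y)) ⊔ (n ∸ n)       ≡⟨ cong ((n ∸ (toℕ (x *) + toℕ y)) ⊔_) (n∸n≡0 n) ⟩
    (n ∸ (toℕ (x *) + toℕ y)) ⊔ 0             ≡⟨ ⊔-identityʳ _ ⟩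
    n ∸ (toℕ (x *) + toℕ y)                   ≡⟨ sym (∸-+-assoc n (toℕ (x *)) (toℕ y)) ⟩
    (n ∸ toℕ (x *)) ∸ toℕ y                   ≡⟨ cong (λ t → (n ∸ t) ∸ toℕ y) (opposite-prop x) ⟩
    (n ∸ (n ∸ toℕ x)) ∸ toℕ y                 ≡⟨ cong (_∸ toℕ y) (m∸[m∸n]≡n (toℕ≤n x)) ⟩
    toℕ x ∸ toℕ y                             ∎

  ⊖-identityʳ : (x : Ł n) → x ⊖ 𝟘 ≡ x
  ⊖-identityʳ x = toℕ-injective (toℕ-⊖ x 𝟘)

  ⊖-⊤ : (x : Ł n) → x ⊖ ⊤ ≡ 𝟘
  ⊖-⊤ x = toℕ-injective (trans (toℕ-⊖ x ⊤)
    (m≤n⇒m∸n≡0 (subst (toℕ x ≤_) (sym toℕ-⊤) (toℕ≤n x))))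

  ite : Ł n → Ł n → Ł n → Ł n
  ite e u v = (u ⊖ (e *)) ⊕ (v ⊖ e)

  ite-⊤ : (u v : Ł n) → ite ⊤ u v ≡ u
  ite-⊤ u v = begin
    (u ⊖ (⊤ *)) ⊕ (v ⊖ ⊤)   ≡⟨ cong₂ (λ s t → (u ⊖ s) ⊕ t) (opposite-involutive 𝟘) (⊖-⊤ v) ⟩
    (u ⊖ 𝟘) ⊕ 𝟘             ≡⟨ ⊕-identityʳ (u ⊖ 𝟘) ⟩
    u ⊖ 𝟘                   ≡⟨ ⊖-identityʳ u ⟩
    u                       ∎

  ite-𝟘 : (u v : Ł n) → ite 𝟘 u v ≡ v
  ite-𝟘 u v = begin
    (u ⊖ ⊤) ⊕ (v ⊖ 𝟘)   ≡⟨ cong₂ _⊕_ (⊖-⊤ u) (⊖-identityʳ v) ⟩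
    𝟘 ⊕ v               ≡⟨ ⊕-identityˡ v ⟩
    v                   ∎

  times : ℕ → Ł n → Ł n
  times zero    x = 𝟘
  times (suc m) x = x ⊕ times m x

  +-⊓-absorb : (a b : ℕ) → (a + b ⊓ n) ⊓ n ≡ (a + b) ⊓ n
  +-⊓-absorb a b = begin
    (a + b ⊓ n) ⊓ n           ≡⟨ cong (_⊓ n) (+-distribˡ-⊓ a b n) ⟩
    ((a + b) ⊓ (a + n)) ⊓ n   ≡⟨ ⊓-assoc (a + b) (a + n) n ⟩
    (a + b) ⊓ ((a + n) ⊓ n)   ≡⟨ cong ((a + b) ⊓_) (m≥n⇒m⊓n≡n (m≤n+m n a)) ⟩
    (a + b) ⊓ n               ∎

  toℕ-times : (m : ℕ) (x : Ł n) → toℕ (times m x) ≡ (m * toℕ x) ⊓ n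
  toℕ-times zero    x = refl
  toℕ-times (suc m) x = begin
    toℕ (x ⊕ times m x)                   ≡⟨ toℕ-⊕ x (times m x) ⟩
    (toℕ x + toℕ (times m x)) ⊓ n         ≡⟨ cong (λ t → (toℕ x + t) ⊓ n) (toℕ-times m x) ⟩
    (toℕ x + (m * toℕ x) ⊓ n) ⊓ n         ≡⟨ +-⊓-absorb (toℕ x) (m * toℕ x) ⟩
    (toℕ x + m * toℕ x) ⊓ n               ∎

  -- sign x is 0 if x = 0 and 1 otherwise: the n-fold sum of any x > 0
  -- reaches 1, since x ≥ 1/n.
  sign : Ł n → Ł n
  sign = times n

  sign-𝟘 : sign 𝟘 ≡ 𝟘
  sign-𝟘 = toℕ-injective (trans (toℕ-times n 𝟘) (cong (_⊓ n) (*-zeroʳ n)))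

  sign-nonzero : (x : Ł n) → ¬ x ≡ 𝟘 → sign x ≡ ⊤
  sign-nonzero x x≢𝟘 = toℕ-injective (begin
    toℕ (times n x)      ≡⟨ toℕ-times n x ⟩
    (n * toℕ x) ⊓ n      ≡⟨ m≥n⇒m⊓n≡n (n≤n*x (toℕ x) refl) ⟩
    n                    ≡⟨ sym toℕ-⊤ ⟩
    toℕ ⊤                ∎)
    where
    n≤n*x : (k : ℕ) → toℕ x ≡ k → n ≤ n * k
    n≤n*x zero    x≡0 = ⊥-elim (x≢𝟘 (toℕ-injective x≡0))
    n≤n*x (suc k) _   = m≤m*n n (suc k)

  dist : Ł n → Ł n → Ł n
  dist x a = (x ⊖ a) ⊕ (a ⊖ x)

  dist-self : (a : Ł n) → dist a a ≡ 𝟘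
  dist-self a = trans (cong₂ _⊕_ (⊖-self a) (⊖-self a)) (⊕-identityˡ 𝟘)
    where
    ⊖-self : (x : Ł n) → x ⊖ x ≡ 𝟘
    ⊖-self x = toℕ-injective (trans (toℕ-⊖ x x) (n∸n≡0 (toℕ x)))

  dist-𝟘⇒≡ : (x a : Ł n) → dist x a ≡ 𝟘 → x ≡ a
  dist-𝟘⇒≡ x a d≡𝟘 = toℕ-injective (≤-antisym (part-≤ x a (⊕-inflationaryˡ _ _))
                                               (part-≤ a x (⊕-inflationaryʳ _ _)))
    where
    part-≤ : (u v : Ł n) → toℕ (u ⊖ v) ≤ toℕ (dist x a) → toℕ u ≤ toℕ v
    part-≤ u v le = m∸n≡0⇒m≤n (n≤0⇒n≡0 (subst₂ _≤_ (toℕ-⊖ u v) (cong toℕ d≡𝟘) le))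

module _ {n : ℕ} where

  gen-⊖ : {f g : Ł n → Ł n} → Generated f → Generated g → Generated (λ x → f x ⊖ g x)
  gen-⊖ p q = gen-* (gen-⊕ (gen-* p) q)

  gen-ite : {e f g : Ł n → Ł n} → Generated e → Generated f → Generated g →
            Generated (λ x → ite (e x) (f x) (g x))
  gen-ite p q r = gen-⊕ (gen-⊖ q (gen-* p)) (gen-⊖ r p)

  gen-times : (m : ℕ) {f : Ł n → Ł n} → Generated f → Generated (λ x → times m (f x))
  gen-times zero    p = gen-zero
  gen-times (suc m) p = gen-⊕ p (gen-times m p)

  gen-unequal : (a : Ł n) → Generated (λ x → sign (dist x a))
  gen-unequal a = gen-times n (gen-⊕ (gen-⊖ gen-id (gen-const a)) (gen-⊖ (gen-const a) gen-id))

module _ {n : ℕ} (f : Ł n → Ł n) where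

  interpolate : List (Ł n) → Ł n → Ł n
  interpolate []      x = 𝟘
  interpolate (a ∷ l) x = ite (sign (dist x a)) (interpolate l x) (f a)

  gen-interpolate : (l : List (Ł n)) → Generated (interpolate l)
  gen-interpolate []      = gen-zero
  gen-interpolate (a ∷ l) = gen-ite (gen-unequal a) (gen-interpolate l) (gen-const (f a))

  interpolate-correct : (l : List (Ł n)) (x : Ł n) → x ∈ l → interpolate l x ≡ f x
  interpolate-correct (a ∷ l) x x∈a∷l with x ≟ a
  ... | yes refl = begin
    ite (sign (dist x x)) (interpolate l x) (f x)   ≡⟨ cong (λ e → ite e (interpolate l x) (f x)) sign-dist-self ⟩
    ite 𝟘 (interpolate l x) (f x)                   ≡⟨ ite-𝟘 (interpolate l x) (f x) ⟩
    f x                                             ∎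
    where
    sign-dist-self : sign (dist x x) ≡ 𝟘
    sign-dist-self = trans (cong sign (dist-self x)) sign-𝟘
  ... | no x≢a = begin
    ite (sign (dist x a)) (interpolate l x) (f a)   ≡⟨ cong (λ e → ite e (interpolate l x) (f a)) sign-dist ⟩
    ite ⊤ (interpolate l x) (f a)                   ≡⟨ ite-⊤ (interpolate l x) (f a) ⟩
    interpolate l x                                 ≡⟨ interpolate-correct l x (in-tail x∈a∷l) ⟩
    f x                                             ∎
    where
    sign-dist : sign (dist x a) ≡ ⊤
    sign-dist = sign-nonzero (dist x a) (λ d≡𝟘 → x≢a (dist-𝟘⇒≡ x a d≡𝟘))
    in-tail : x ∈ a ∷ l → x ∈ l
    in-tail (here x≡a) = ⊥-elim (x≢a x≡a)
    in-tail (there x∈l) = x∈l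

mainTheorem5 : (n : ℕ) → 1 ≤ n → (f : Ł n → Ł n) →
    Σ (Ł n → Ł n) (λ g → Generated g × ((x : Ł n) → g x ≡ f x))
mainTheorem5 n _ f = interpolate f points , gen-interpolate f points ,
  λ x → interpolate-correct f points x (∈-allFin x)
  where
  points : List (Ł n)
  points = allFin (suc n)
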